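{- Let $\mathcal{A}$ be a primitive integral Apollonian circle packing and let $\mathcal{C}$ be a circle of $\mathcal{A}$ with curvature $n$. Then there is a circle of $\mathcal{A}$ tangent to $\mathcal{C}$ whose curvature is coprime to $6n$.
   Context: Apollonian packings: start from four mutually tangent circles in the plane (lines allowed) and repeatedly add, for every triple of mutually tangent circles present, the two circles tangent to all three. Curvatures are signed ($1/\text{radius}$; lines $0$; a circle containing the others in its interior is negative). Primitive integral: all curvatures integers with overall gcd $1$. -}

module Defs where

open import Data.Fin using (Fin; zero; suc; _≟_)
open import Data.Integer using (ℤ; _+_; _-_; _*_; _>_; +_; 0ℤ; 1ℤ)
open import Data.Integer.GCD using (gcd)
open import Relation.Nullary using (yes; no; ¬_)
open import Relation.Binary.PropositionalEquality using (_≡_)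
open import Data.Product using (_×_)

-- An (ordered) Descartes quadruple of signed curvatures of four mutually
-- tangent circles (lines have curvature 0).
Quad : Set
Quad = Fin 4 → ℤ

total : Quad → ℤ
total q = q zero + q (suc zero) + q (suc (suc zero)) + q (suc (suc (suc zero)))

sq : ℤ → ℤ
sq x = x * x

Descartes : Quad → Set
Descartes q = sq (total q) ≡ (+ 2) * (sq (q zero) + sq (q (suc zero))
                                    + sq (q (suc (suc zero))) + sq (q (suc (suc (suc zero)))))

-- Genuine (positively oriented) Descartes quadruple: integral solution of the
-- Descartes equation on the positive nappe of the light cone (total > 0).
-- Every such integer vector is the curvature vector of an actual Descartes
-- configuration with the standard sign convention.
IntegralDescartesQuad : Quad → Set
IntegralDescartesQuad q = Descartes q × total q > 0ℤ

Primitive : Quad → Set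
Primitive q = gcd (gcd (q zero) (q (suc zero)))
                  (gcd (q (suc (suc zero))) (q (suc (suc (suc zero))))) ≡ 1ℤ

-- Apollonian move S_i: replace the i-th circle by the other circle tangent to
-- the remaining three:  a_i' = 2 (sum of the other three) - a_i.
move : Fin 4 → Quad → Quad
move i q j with j ≟ i
... | yes _ = (+ 2) * (total q - q i) - q i
... | no  _ = q j

-- Quadruples of mutually tangent circles of the packing generated from q
-- (the Apollonian group orbit, keeping track of positions).
data Reach : Quad → Quad → Set where
  here : ∀ {q} → Reach q q
  step : ∀ {q r} (i : Fin 4) → Reach q r → Reach q (move i r)

-- Quadruples reachable from q by moves S_j with j ≢ i, i.e. those that still
-- contain the i-th circle of q (in position i).  The circles tangent to the
-- i-th circle of q are exactly the other entries of such quadruples.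
data ReachFix (i : Fin 4) : Quad → Quad → Set where
  here : ∀ {q} → ReachFix i q q
  step : ∀ {q r} (j : Fin 4) → ¬ (j ≡ i) → ReachFix i q r → ReachFix i q (move j r)

-- Relabel the quadruple so that the given circle C, of curvature n, comes first, and pick a
-- neighbour of curvature a.  The circles tangent to both form a chain with curvatures
-- P(z) = (n + a) z² + (n + a + b - c) z + b, and Descartes' relation becomes
-- 4 (n + a) (P(z) + n) = P′(z)² + 4 n², so a prime of n dividing P(z) divides P′(z).
-- If n ≠ 0: Descartes' relation and primitivity give a neighbour and z₀ with P(z₀) prime to 6.
-- Shifting z₀ by a suitable multiple of 6 keeps this and makes P′(z) prime to n (a prime of n
-- dividing n + a would divide every curvature), so P(z) is prime to 6n.
-- If n = 0 (C is a line): a z with 0 ≤ P′(z) < 2|a| has |P(z)| < |a|, so one can descend on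
-- |a| until P(z) = 0; the chain circle next to it has curvature a, which must then be ± 1.

{-# OPTIONS --safe #-}
module Submission where

open import Defs
open import Data.Fin using (Fin)
open import Data.Integer using (ℤ; _*_; +_)
open import Data.Integer.Coprimality using (Coprime)
open import Data.Product using (Σ; _×_)
open import Relation.Nullary using (¬_)
open import Relation.Binary.PropositionalEquality using (_≡_)

open import Algebra.Properties.CommutativeMonoid.Sum as Sum using ()
open import Data.Empty using (⊥; ⊥-elim)
open import Data.Fin using (suc; punchIn; _≟_)
open import Data.Fin.Patterns using (0F; 1F; 2F; 3F)
open import Data.Fin.Permutation using (Permutation′; _⟨$⟩ʳ_; _⟨$⟩ˡ_; id; transpose; _∘ₚ_; inverseʳ)
open import Data.Fin.Properties using (punchInᵢ≢i; 0≢1+n)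
open import Data.Integer using (_+_; _-_; -_; 0ℤ; 1ℤ; -1ℤ; ∣_∣; -[1+_]; ≢-nonZero; _/_; _%_)
open import Data.Integer.Divisibility.Signed
  using ( _∣_; divides; _∣?_; ∣ᵤ⇒∣; ∣⇒∣ᵤ; ∣-refl; ∣-trans
        ; ∣m∣n⇒∣m+n; ∣m∣n⇒∣m-n; ∣m+n∣m⇒∣n; ∣m+n∣n⇒∣m; ∣n⇒∣m*n; ∣m⇒∣m*n; ∣m⇒∣-m)
open import Data.Integer.DivMod using (a≡a%n+[a/n]*n; n%d<d)
import Data.Integer.GCD as ℤ
import Data.Integer.Properties as ℤ
open import Data.Integer.Tactic.RingSolver using (solve-∀)
open import Data.List.Base using (_∷_)
open import Data.List.Relation.Unary.All using (_∷_)
open import Data.Nat.Base as ℕ using (ℕ; NonZero; ≢-nonZero⁻¹; s≤s; z≤n)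
open import Data.Nat.Coprimality as ℕ using (gcd≡1⇒coprime)
import Data.Nat.Divisibility as ℕ
open import Data.Nat.GCD using (gcd; gcd[m,n]∣m; gcd[m,n]∣n; gcd[m,n]≡0⇒m≡0)
open import Data.Nat.Induction using (<-wellFounded)
open import Data.Nat.ListAction using (product)
open import Data.Nat.Primality using (Prime; prime?; prime[2]; ¬prime[1]; euclidsLemma; prime⇒irreducible)
open import Data.Nat.Primality.Factorisation using (factorise)
import Data.Nat.Properties as ℕ
import Data.Nat.Tactic.RingSolver as ℕ
open import Data.Product using (∃; _,_)
open import Data.Sum using (_⊎_; inj₁; inj₂; [_,_]′; map; reduce)
open import Function using (_∘_; case_of_)
open import Induction.WellFounded using (Acc; acc)
open import Relation.Nullary using (yes; no; contradiction)
open import Relation.Nullary.Decidable using (from-yes)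
open import Relation.Binary.PropositionalEquality
  using (_≢_; _≗_; refl; sym; trans; cong; cong₂; subst; subst₂; module ≡-Reasoning)
open import Function.Bundles using (Injection)
open import Function.Properties.Inverse using (↔⇒↣)

open Sum ℤ.+-0-commutativeMonoid using (sum; sum-permute; sum-remove; sum-cong-≗)
open ≡-Reasoning

relabel : Permutation′ 4 → Quad → Quad
relabel π q = q ∘ (π ⟨$⟩ʳ_)

perm-injective : ∀ (π : Permutation′ 4) {k l} → π ⟨$⟩ʳ k ≡ π ⟨$⟩ʳ l → k ≡ l
perm-injective π = Injection.injective (↔⇒↣ π)

sum≡total : ∀ q → sum q ≡ total q
sum≡total q = reassociate (q 0F) (q 1F) (q 2F) (q 3F)
  where
  reassociate : ∀ a b c d → a + (b + (c + (d + 0ℤ))) ≡ a + b + c + d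
  reassociate = solve-∀

total-cong : ∀ {q r} → q ≗ r → total q ≡ total r
total-cong q≗r = cong₂ _+_ (cong₂ _+_ (cong₂ _+_ (q≗r 0F) (q≗r 1F)) (q≗r 2F)) (q≗r 3F)

total-relabel : ∀ π q → total (relabel π q) ≡ total q
total-relabel π q = begin
  total (relabel π q) ≡⟨ sum≡total (relabel π q) ⟨
  sum (relabel π q)   ≡⟨ sum-permute q π ⟨
  sum q               ≡⟨ sum≡total q ⟩
  total q             ∎

total-update : ∀ j q r → (∀ {k} → k ≢ j → r k ≡ q k) → total r ≡ total q - q j + r j
total-update j q r r≡q = begin
  total r                               ≡⟨ sum≡total r ⟨
  sum r                                 ≡⟨ sum-remove r ⟩
  r j + sum (r ∘ punchIn j)             ≡⟨ cong (λ s → r j + s) (sum-cong-≗ (r≡q ∘ punchInᵢ≢i j)) ⟩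
  r j + sum (q ∘ punchIn j)             ≡⟨ exchange (q j) (r j) _ ⟩
  q j + sum (q ∘ punchIn j) - q j + r j ≡⟨ cong (λ s → s - q j + r j) (sum-remove q) ⟨
  sum q - q j + r j                     ≡⟨ cong (λ s → s - q j + r j) (sum≡total q) ⟩
  total q - q j + r j                   ∎
  where
  exchange : ∀ x y s → y + s ≡ x + s - x + y
  exchange = solve-∀

move-≡ : ∀ j q → move j q j ≡ + 2 * (total q - q j) - q j
move-≡ j q with j ≟ j
... | yes _   = refl
... | no j≢j = contradiction refl j≢j

move-≢ : ∀ j q {k} → k ≢ j → move j q k ≡ q k
move-≢ j q {k} k≢j with k ≟ j
... | yes k≡j = contradiction k≡j k≢j
... | no _    = refl

move-cong : ∀ j {q r} → q ≗ r → move j q ≗ move j r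
move-cong j {q} {r} q≗r k with k ≟ j
... | yes refl = cong₂ (λ t x → + 2 * (t - x) - x) (total-cong q≗r) (q≗r k)
... | no _     = q≗r k

move-relabel : ∀ π j q → move (π ⟨$⟩ʳ j) q ∘ (π ⟨$⟩ʳ_) ≗ move j (relabel π q)
move-relabel π j q k with k ≟ j
... | yes refl = begin
  move (π ⟨$⟩ʳ k) q (π ⟨$⟩ʳ k)        ≡⟨ move-≡ (π ⟨$⟩ʳ k) q ⟩
  + 2 * (total q - x) - x             ≡⟨ cong (λ t → + 2 * (t - x) - x) (total-relabel π q) ⟨
  + 2 * (total (relabel π q) - x) - x ∎
  where x = q (π ⟨$⟩ʳ k)
... | no k≢j = move-≢ (π ⟨$⟩ʳ j) q (k≢j ∘ perm-injective π)

total-move : ∀ j q → total (move j q) ≡ total q - q j + move j q j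
total-move j q = total-update j q (move j q) (move-≢ j q)

move-involutive : ∀ j q → move j (move j q) ≗ q
move-involutive j q k with k ≟ j
... | no k≢j   = move-≢ j q k≢j
... | yes refl = begin
  + 2 * (total (move k q) - y′) - y′ ≡⟨ cong (λ t → + 2 * (t - y′) - y′) (total-move k q) ⟩
  + 2 * (total q - x + y′ - y′) - y′ ≡⟨ cong (λ y′ → + 2 * (total q - x + y′ - y′) - y′) (move-≡ k q) ⟩
  + 2 * (total q - x + y - y) - y    ≡⟨ involution (total q) x ⟩
  x                                  ∎
  where
  x = q k
  y = + 2 * (total q - x) - x
  y′ = move k q k
  involution : ∀ T x → + 2 * (T - x + (+ 2 * (T - x) - x) - (+ 2 * (T - x) - x)) - (+ 2 * (T - x) - x) ≡ x
  involution = solve-∀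

MoveInvariant : (Quad → Set) → Set
MoveInvariant P = ∀ j {q} → P q → P (move j q)

RelabelInvariant : (Quad → Set) → Set
RelabelInvariant P = ∀ π {q r} → r ≗ relabel π q → P q → P r

reach-preserves : ∀ P → MoveInvariant P → ∀ {r q} → Reach r q → P r → P q
reach-preserves P inv here         = Function.id
reach-preserves P inv (step j r⇝q) = inv j ∘ reach-preserves P inv r⇝q

reachFix-preserves : ∀ P → MoveInvariant P → ∀ {i q r} → ReachFix i q r → P q → P r
reachFix-preserves P inv here           = Function.id
reachFix-preserves P inv (step j _ q⇝r) = inv j ∘ reachFix-preserves P inv q⇝r

descartesDefect : Quad → ℤ
descartesDefect q = sq (total q) - + 2 * total (sq ∘ q)

descartes⇒defect≡0 : ∀ {q} → Descartes q → descartesDefect q ≡ 0ℤ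
descartes⇒defect≡0 = ℤ.i≡j⇒i-j≡0

defect≡0⇒descartes : ∀ {q} → descartesDefect q ≡ 0ℤ → Descartes q
defect≡0⇒descartes = ℤ.i-j≡0⇒i≡j _ _

descartesDefect-move : ∀ j q → descartesDefect (move j q) ≡ descartesDefect q
descartesDefect-move j q = begin
  sq (total (move j q)) - + 2 * total (sq ∘ move j q)
    ≡⟨ cong₂ (λ T S → sq T - + 2 * S) (total-move j q)
             (total-update j (sq ∘ q) (sq ∘ move j q) (cong sq ∘ move-≢ j q)) ⟩
  sq (T - x + y′) - + 2 * (S - sq x + sq y′)
    ≡⟨ cong (λ y′ → sq (T - x + y′) - + 2 * (S - sq x + sq y′)) (move-≡ j q) ⟩
  sq (T - x + y) - + 2 * (S - sq x + sq y)
    ≡⟨ invariance T S x ⟩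
  sq T - + 2 * S
    ∎
  where
  T = total q
  S = total (sq ∘ q)
  x = q j
  y = + 2 * (T - x) - x
  y′ = move j q j
  invariance : ∀ T S x → (T - x + (+ 2 * (T - x) - x)) * (T - x + (+ 2 * (T - x) - x))
                         - + 2 * (S - x * x + (+ 2 * (T - x) - x) * (+ 2 * (T - x) - x))
                       ≡ T * T - + 2 * S
  invariance = solve-∀

descartes-move : MoveInvariant Descartes
descartes-move j {q} dq =
  defect≡0⇒descartes {move j q} (trans (descartesDefect-move j q) (descartes⇒defect≡0 {q} dq))

descartes-relabel : RelabelInvariant Descartes
descartes-relabel π {q} {r} r≗q dq =
  defect≡0⇒descartes {r} (trans defect-r≡defect-q (descartes⇒defect≡0 {q} dq))
  where
  defect-r≡defect-q : descartesDefect r ≡ descartesDefect q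
  defect-r≡defect-q = cong₂ (λ T S → sq T - + 2 * S)
    (trans (total-cong r≗q) (total-relabel π q))
    (trans (total-cong {sq ∘ r} {sq ∘ relabel π q} (cong sq ∘ r≗q)) (total-relabel π (sq ∘ q)))

Unimodular : Quad → Set
Unimodular q = ∀ d → (∀ k → d ∣ q k) → d ∣ 1ℤ

primitive⇒unimodular : ∀ {q} → Primitive q → Unimodular q
primitive⇒unimodular {q} gcd≡1 d d∣q = ∣ᵤ⇒∣ (subst (ℕ._∣_ ∣ d ∣) (cong ∣_∣ gcd≡1)
  (ℤ.gcd-greatest {ℤ.gcd (q 0F) (q 1F)} {ℤ.gcd (q 2F) (q 3F)} {d}
    (ℤ.gcd-greatest {q 0F} {q 1F} {d} (∣⇒∣ᵤ (d∣q 0F)) (∣⇒∣ᵤ (d∣q 1F)))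
    (ℤ.gcd-greatest {q 2F} {q 3F} {d} (∣⇒∣ᵤ (d∣q 2F)) (∣⇒∣ᵤ (d∣q 3F)))))

∣-total : ∀ {d q} → (∀ k → d ∣ q k) → d ∣ total q
∣-total d∣q = ∣m∣n⇒∣m+n (∣m∣n⇒∣m+n (∣m∣n⇒∣m+n (d∣q 0F) (d∣q 1F)) (d∣q 2F)) (d∣q 3F)

∣-move : ∀ j {d q} → (∀ k → d ∣ q k) → ∀ k → d ∣ move j q k
∣-move j d∣q k with k ≟ j
... | yes refl = ∣m∣n⇒∣m-n (∣n⇒∣m*n (+ 2) (∣m∣n⇒∣m-n (∣-total d∣q) (d∣q k))) (d∣q k)
... | no _     = d∣q k

-- Moves are involutions, so a common divisor of the entries of move j q divides those of q.
unimodular-move : MoveInvariant Unimodular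
unimodular-move j {q} uq d d∣q′ = uq d λ k → subst (d ∣_) (move-involutive j q k) (∣-move j d∣q′ k)

unimodular-relabel : RelabelInvariant Unimodular
unimodular-relabel π {q} r≗q uq d d∣r = uq d λ k →
  subst (d ∣_) (trans (r≗q (π ⟨$⟩ˡ k)) (cong q (inverseʳ π))) (d∣r (π ⟨$⟩ˡ k))

reachFix-trans : ∀ {i q r s} → ReachFix i q r → ReachFix i r s → ReachFix i q s
reachFix-trans q⇝r here             = q⇝r
reachFix-trans q⇝r (step j j≢i r⇝s) = step j j≢i (reachFix-trans q⇝r r⇝s)

reachFix-fixes : ∀ {i q r} → ReachFix i q r → r i ≡ q i
reachFix-fixes here             = refl
reachFix-fixes (step j j≢i q⇝r) = trans (move-≢ j _ (j≢i ∘ sym)) (reachFix-fixes q⇝r)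

reachFix-relabel : ∀ π {k q r s} → r ≗ relabel π q → ReachFix k r s →
                   Σ Quad λ s′ → ReachFix (π ⟨$⟩ʳ k) q s′ × s ≗ relabel π s′
reachFix-relabel π r≗q here = _ , here , r≗q
reachFix-relabel π r≗q (step j j≢k r⇝s) with s′ , q⇝s′ , s≗s′ ← reachFix-relabel π r≗q r⇝s =
  move (π ⟨$⟩ʳ j) s′ , step (π ⟨$⟩ʳ j) (j≢k ∘ perm-injective π) q⇝s′ ,
  λ l → trans (move-cong j s≗s′ l) (sym (move-relabel π j s′ l))

-- Around i q r: r lists the circles of a quadruple reached from q by moves keeping
-- circle i, relabelled so that circle i comes first.
record Around (i : Fin 4) (q r : Quad) : Set where
  field
    {base}   : Quad
    reachFix : ReachFix i q base
    labels   : Permutation′ 4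
    labels-0 : labels ⟨$⟩ʳ 0F ≡ i
    entries  : r ≗ relabel labels base

open Around

around-relabel : ∀ π {i q r} → π ⟨$⟩ʳ 0F ≡ i → r ≗ relabel π q → Around i q r
around-relabel π π0≡i r≗q = record { reachFix = here ; labels = π ; labels-0 = π0≡i ; entries = r≗q }

around-move : ∀ j {q} → j ≢ 0F → Around 0F q (move j q)
around-move j j≢0 = record { reachFix = step j j≢0 here ; labels = id ; labels-0 = refl ; entries = λ _ → refl }

around-trans : ∀ {i q r s} → Around i q r → Around 0F r s → Around i q s
around-trans q⇝r r⇝s with s′ , q⇝s′ , base≗s′ ← reachFix-relabel (labels q⇝r) (entries q⇝r) (reachFix r⇝s) = record
  { reachFix = reachFix-trans (reachFix q⇝r) (subst (λ k → ReachFix k _ s′) (labels-0 q⇝r) q⇝s′)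
  ; labels   = labels r⇝s ∘ₚ labels q⇝r
  ; labels-0 = trans (cong (labels q⇝r ⟨$⟩ʳ_) (labels-0 r⇝s)) (labels-0 q⇝r)
  ; entries  = λ k → trans (entries r⇝s k) (base≗s′ (labels r⇝s ⟨$⟩ʳ k))
  }

around-0 : ∀ {i q r} → Around i q r → r 0F ≡ q i
around-0 q⇝r = trans (entries q⇝r 0F) (trans (cong (base q⇝r) (labels-0 q⇝r)) (reachFix-fixes (reachFix q⇝r)))

around-preserves : ∀ P → MoveInvariant P → RelabelInvariant P → ∀ {i q r} → Around i q r → P q → P r
around-preserves P move-inv relabel-inv q⇝r =
  relabel-inv (labels q⇝r) (entries q⇝r) ∘ reachFix-preserves P move-inv (reachFix q⇝r)

descartes-around : ∀ {i q r} → Around i q r → Descartes q → Descartes r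
descartes-around = around-preserves Descartes descartes-move descartes-relabel

unimodular-around : ∀ {i q r} → Around i q r → Unimodular q → Unimodular r
unimodular-around = around-preserves Unimodular unimodular-move unimodular-relabel

record CoprimeNeighbour (m : ℤ) (q : Quad) : Set where
  constructor neighbour
  field
    {quadruple} : Quad
    around      : Around 0F q quadruple
    position    : Fin 3
    coprime     : Coprime (quadruple (suc position)) m

neighbour-around : ∀ {m q r} → Around 0F q r → CoprimeNeighbour m r → CoprimeNeighbour m q
neighbour-around q⇝r (neighbour r⇝s j coprime) = neighbour (around-trans q⇝r r⇝s) j coprime

-- The chain of circles tangent to circles 0 and 1

-- The circles tangent to circles 0 and 1 of q form a chain in which consecutive members
-- have curvatures chain q z and chain q (z - 1), starting from (q 2, q 3): the move replacing
-- the older one is the recurrence P(z + 1) = 2 (q 0 + q 1 + P z) - P(z - 1), solved by P = chain q.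
chain : Quad → ℤ → ℤ
chain q z = (q 0F + q 1F) * z * z + (q 0F + q 1F + q 2F - q 3F) * z + q 2F

slope : Quad → ℤ → ℤ
slope q z = + 2 * (q 0F + q 1F) * z + (q 0F + q 1F + q 2F - q 3F)

quad : ℤ → ℤ → ℤ → ℤ → Quad
quad a b c d 0F = a
quad a b c d 1F = b
quad a b c d 2F = c
quad a b c d 3F = d

chainQuad : Quad → ℤ → Quad
chainQuad q z = quad (q 0F) (q 1F) (chain q z) (chain q (z - 1ℤ))

chain[0] : ∀ q → chain q 0ℤ ≡ q 2F
chain[0] q = identity (q 0F + q 1F) (q 2F) (q 3F)
  where
  identity : ∀ A b c → A * 0ℤ * 0ℤ + (A + b - c) * 0ℤ + b ≡ b
  identity = solve-∀

chain[-1] : ∀ q → chain q -1ℤ ≡ q 3F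
chain[-1] q = identity (q 0F + q 1F) (q 2F) (q 3F)
  where
  identity : ∀ A b c → A * -1ℤ * -1ℤ + (A + b - c) * -1ℤ + b ≡ c
  identity = solve-∀

chain-+ : ∀ q z h → chain q (z + h) ≡ chain q z + h * (slope q z + (q 0F + q 1F) * h)
chain-+ q z h = identity (q 0F + q 1F) (q 2F) (q 3F) z h
  where
  identity : ∀ A b c z h → A * (z + h) * (z + h) + (A + b - c) * (z + h) + b
                         ≡ A * z * z + (A + b - c) * z + b + h * (+ 2 * A * z + (A + b - c) + A * h)
  identity = solve-∀

slope-+ : ∀ q z h → slope q (z + h) ≡ slope q z + + 2 * (q 0F + q 1F) * h
slope-+ q z h = identity (q 0F + q 1F) (q 2F) (q 3F) z h
  where
  identity : ∀ A b c z h → + 2 * A * (z + h) + (A + b - c) ≡ + 2 * A * z + (A + b - c) + + 2 * A * h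
  identity = solve-∀

chainQuad[0] : ∀ q → chainQuad q 0ℤ ≗ q
chainQuad[0] q 0F = refl
chainQuad[0] q 1F = refl
chainQuad[0] q 2F = chain[0] q
chainQuad[0] q 3F = chain[-1] q

-- Stated at 1ℤ + z and -1ℤ + z, which compute to + suc k and -[1+ suc k] for the induction
-- in around-chainQuad.
chainQuad-suc : ∀ q z → chainQuad q (1ℤ + z) ≗ relabel (transpose 2F 3F) (move 3F (chainQuad q z))
chainQuad-suc q z 0F = refl
chainQuad-suc q z 1F = refl
chainQuad-suc q z 2F = identity (q 0F + q 1F) (q 2F) (q 3F) z
  where
  identity : ∀ A b c z →
    A * (1ℤ + z) * (1ℤ + z) + (A + b - c) * (1ℤ + z) + b
      ≡ + 2 * (A + (A * z * z + (A + b - c) * z + b) + (A * (z - 1ℤ) * (z - 1ℤ) + (A + b - c) * (z - 1ℤ) + b)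
               - (A * (z - 1ℤ) * (z - 1ℤ) + (A + b - c) * (z - 1ℤ) + b))
        - (A * (z - 1ℤ) * (z - 1ℤ) + (A + b - c) * (z - 1ℤ) + b)
  identity = solve-∀
chainQuad-suc q z 3F = cong (chain q) (cancel z)
  where
  cancel : ∀ z → 1ℤ + z - 1ℤ ≡ z
  cancel = solve-∀

chainQuad-pred : ∀ q z → chainQuad q (-1ℤ + z) ≗ relabel (transpose 2F 3F) (move 2F (chainQuad q z))
chainQuad-pred q z 0F = refl
chainQuad-pred q z 1F = refl
chainQuad-pred q z 2F = cong (chain q) (ℤ.+-comm -1ℤ z)
chainQuad-pred q z 3F = identity (q 0F + q 1F) (q 2F) (q 3F) z
  where
  identity : ∀ A b c z →
    A * (-1ℤ + z - 1ℤ) * (-1ℤ + z - 1ℤ) + (A + b - c) * (-1ℤ + z - 1ℤ) + b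
      ≡ + 2 * (A + (A * z * z + (A + b - c) * z + b) + (A * (z - 1ℤ) * (z - 1ℤ) + (A + b - c) * (z - 1ℤ) + b)
               - (A * z * z + (A + b - c) * z + b))
        - (A * z * z + (A + b - c) * z + b)
  identity = solve-∀

around-chainStep : ∀ j {q r} → j ≢ 0F → r ≗ relabel (transpose 2F 3F) (move j q) → Around 0F q r
around-chainStep j j≢0 r≗q = around-trans (around-move j j≢0) (around-relabel (transpose 2F 3F) refl r≗q)

around-chainQuad : ∀ q z → Around 0F q (chainQuad q z)
around-chainQuad q (+ k)    = upward k
  where
  upward : ∀ k → Around 0F q (chainQuad q (+ k))
  upward ℕ.zero    = around-relabel id refl (chainQuad[0] q)
  upward (ℕ.suc k) = around-trans (upward k) (around-chainStep 3F (λ ()) (chainQuad-suc q (+ k)))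
around-chainQuad q -[1+ k ] = downward k
  where
  downward : ∀ k → Around 0F q (chainQuad q -[1+ k ])
  downward ℕ.zero    = around-trans (around-chainQuad q 0ℤ) (around-chainStep 2F (λ ()) (chainQuad-pred q 0ℤ))
  downward (ℕ.suc k) = around-trans (downward k) (around-chainStep 2F (λ ()) (chainQuad-pred q -[1+ k ]))

chain-neighbour : ∀ {m} q z → Coprime (chain q z) m → CoprimeNeighbour m q
chain-neighbour q z coprime = neighbour (around-chainQuad q z) 1F coprime

no-common-prime⇒coprime : ∀ {m n} → (∀ {p} → Prime p → p ℕ.∣ m → p ℕ.∣ n → ⊥) → ℕ.Coprime m n
no-common-prime⇒coprime h {ℕ.zero} (0∣m , 0∣n) with refl ← ℕ.0∣⇒≡0 0∣m | refl ← ℕ.0∣⇒≡0 0∣n =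
  ⊥-elim (h prime[2] (2 ℕ.∣0) (2 ℕ.∣0))
no-common-prime⇒coprime h {1} _ = refl
no-common-prime⇒coprime h {d@(ℕ.suc (ℕ.suc _))} (d∣m , d∣n) with factorise d
... | record { factors = p ∷ ps ; isFactorisation = d≡p*ps ; factorsPrime = prime-p ∷ _ } =
  ⊥-elim (h prime-p (ℕ.∣-trans p∣d d∣m) (ℕ.∣-trans p∣d d∣n))
  where
  p∣d : p ℕ.∣ d
  p∣d = subst (p ℕ.∣_) (sym d≡p*ps) (ℕ.m∣m*n (product ps))

coprime-part : ∀ x m .{{_ : NonZero m}} →
               ∃ λ t → ℕ.Coprime t x × (∀ {p} → Prime p → p ℕ.∣ m → p ℕ.∣ x ⊎ p ℕ.∣ t)
coprime-part x m = go m (<-wellFounded m)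
  where
  go : ∀ m → Acc ℕ._<_ m → .{{NonZero m}} →
       ∃ λ t → ℕ.Coprime t x × (∀ {p} → Prime p → p ℕ.∣ m → p ℕ.∣ x ⊎ p ℕ.∣ t)
  go m (acc smaller) with gcd m x in g≡ | gcd[m,n]∣m m x | gcd[m,n]∣n m x
  ... | 0 | _ | _ = ⊥-elim (≢-nonZero⁻¹ m (gcd[m,n]≡0⇒m≡0 g≡))
  ... | 1 | _ | _ = m , gcd≡1⇒coprime g≡ , λ _ → inj₂
  ... | g@(ℕ.suc (ℕ.suc _)) | ℕ.divides k@(ℕ.suc _) refl | g∣x
    with t , t⊥x , split ← go k (smaller (ℕ.m<m*n k g (s≤s (s≤s z≤n)))) =
    t , t⊥x , λ prime-p p∣kg → [ split prime-p , (λ p∣g → inj₁ (ℕ.∣-trans p∣g g∣x)) ]′ (euclidsLemma k g prime-p p∣kg)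

prime∣prime⇒≡ : ∀ {p q} → Prime p → Prime q → p ℕ.∣ q → p ≡ q
prime∣prime⇒≡ prime-p prime-q p∣q with prime⇒irreducible prime-q p∣q
... | inj₁ refl = contradiction prime-p ¬prime[1]
... | inj₂ p≡q  = p≡q

prime[3] : Prime 3
prime[3] = from-yes (prime? 3)

prime∣6 : ∀ {p} → Prime p → p ℕ.∣ 6 → p ≡ 2 ⊎ p ≡ 3
prime∣6 prime-p p∣6 = map (prime∣prime⇒≡ prime-p prime[2]) (prime∣prime⇒≡ prime-p prime[3])
                          (euclidsLemma 2 3 prime-p p∣6)

euclidsLemmaℤ : ∀ {p} x y → Prime p → + p ∣ x * y → (+ p ∣ x) ⊎ (+ p ∣ y)
euclidsLemmaℤ {p} x y prime-p p∣xy =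
  map ∣ᵤ⇒∣ ∣ᵤ⇒∣ (euclidsLemma ∣ x ∣ ∣ y ∣ prime-p (subst (p ℕ.∣_) (ℤ.abs-* x y) (∣⇒∣ᵤ p∣xy)))

prime∤1 : ∀ {p} → Prime p → ¬ + p ∣ 1ℤ
prime∤1 prime-p p∣1 = ¬prime[1] (subst Prime (ℕ.∣1⇒≡1 (∣⇒∣ᵤ p∣1)) prime-p)

no-common-prime⇒coprimeℤ : ∀ {x y} → (∀ {p} → Prime p → + p ∣ x → + p ∣ y → ⊥) → Coprime x y
no-common-prime⇒coprimeℤ h = no-common-prime⇒coprime λ prime-p p∣x p∣y → h prime-p (∣ᵤ⇒∣ p∣x) (∣ᵤ⇒∣ p∣y)

-- Descartes' relation says that the binary quadratic form (x, y) ↦ (q 0 + q 1) x² + (slope q 0) x y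
-- + (q 0 + q 2) y², whose values at (z, 1) are chain q z + q 0, has discriminant -4 (q 0)².
key-identity : ∀ q z → Descartes q →
  + 4 * (q 0F + q 1F) * (chain q z + q 0F) ≡ slope q z * slope q z + + 4 * q 0F * q 0F
key-identity q z dq = ℤ.i-j≡0⇒i≡j _ _ (trans (identity (q 0F) (q 1F) (q 2F) (q 3F) z) (descartes⇒defect≡0 {q} dq))
  where
  identity : ∀ n a b c z →
    + 4 * (n + a) * ((n + a) * z * z + (n + a + b - c) * z + b + n)
      - ((+ 2 * (n + a) * z + (n + a + b - c)) * (+ 2 * (n + a) * z + (n + a + b - c)) + + 4 * n * n)
    ≡ (n + a + b + c) * (n + a + b + c) - + 2 * (n * n + a * a + b * b + c * c)
  identity = solve-∀

prime∣slope : ∀ q {p} z → Descartes q → Prime p → + p ∣ q 0F → + p ∣ chain q z → + p ∣ slope q z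
prime∣slope q {p} z dq prime-p p∣n p∣P = reduce (euclidsLemmaℤ w w prime-p p∣w²)
  where
  w = slope q z
  p∣w²+4n² : + p ∣ w * w + + 4 * q 0F * q 0F
  p∣w²+4n² = subst (+ p ∣_) (key-identity q z dq) (∣n⇒∣m*n (+ 4 * (q 0F + q 1F)) (∣m∣n⇒∣m+n p∣P p∣n))
  p∣w² : + p ∣ w * w
  p∣w² = ∣m+n∣n⇒∣m p∣w²+4n² (∣n⇒∣m*n (+ 4 * q 0F) p∣n)

∣-entries : ∀ q {d} z → d ∣ q 0F → d ∣ q 0F + q 1F → d ∣ slope q z → d ∣ chain q z → ∀ k → d ∣ q k
∣-entries q {d} z d∣n d∣A d∣w d∣P = λ { 0F → d∣n ; 1F → d∣a ; 2F → d∣b ; 3F → d∣c }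
  where
  d∣a : d ∣ q 1F
  d∣a = ∣m+n∣m⇒∣n d∣A d∣n
  d∣B : d ∣ q 0F + q 1F + q 2F - q 3F
  d∣B = ∣m+n∣m⇒∣n d∣w (∣m⇒∣m*n z (∣n⇒∣m*n (+ 2) d∣A))
  d∣b : d ∣ q 2F
  d∣b = ∣m+n∣m⇒∣n d∣P (∣m∣n⇒∣m+n (∣m⇒∣m*n z (∣m⇒∣m*n z d∣A)) (∣m⇒∣m*n z d∣B))
  d∣c : d ∣ q 3F
  d∣c = subst (d ∣_) (ℤ.neg-involutive (q 3F)) (∣m⇒∣-m (∣m+n∣m⇒∣n d∣B (∣m∣n⇒∣m+n d∣A d∣b)))

prime∣q₁₂₃⇒prime∣q₀ : ∀ q {p} → Descartes q → Prime p → + p ∣ q 1F → + p ∣ q 2F → + p ∣ q 3F → + p ∣ q 0F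
prime∣q₁₂₃⇒prime∣q₀ q {p} dq prime-p p∣a p∣b p∣c = reduce (euclidsLemmaℤ n n prime-p p∣n²)
  where
  n = q 0F
  s = q 1F + q 2F + q 3F
  p∣s : + p ∣ s
  p∣s = ∣m∣n⇒∣m+n (∣m∣n⇒∣m+n p∣a p∣b) p∣c
  p∣squares : + p ∣ q 1F * q 1F + q 2F * q 2F + q 3F * q 3F
  p∣squares = ∣m∣n⇒∣m+n (∣m∣n⇒∣m+n (∣n⇒∣m*n (q 1F) p∣a) (∣n⇒∣m*n (q 2F) p∣b)) (∣n⇒∣m*n (q 3F) p∣c)
  p∣rest : + p ∣ n * (+ 2 * s) + (s * s - + 2 * (q 1F * q 1F + q 2F * q 2F + q 3F * q 3F))
  p∣rest = ∣m∣n⇒∣m+n (∣n⇒∣m*n n (∣n⇒∣m*n (+ 2) p∣s)) (∣m∣n⇒∣m-n (∣n⇒∣m*n s p∣s) (∣n⇒∣m*n (+ 2) p∣squares))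
  p∣defect : + p ∣ descartesDefect q
  p∣defect = subst (+ p ∣_) (sym (descartes⇒defect≡0 {q} dq)) (divides 0ℤ refl)
  p∣n² : + p ∣ n * n
  p∣n² = subst (+ p ∣_) (sym (identity n (q 1F) (q 2F) (q 3F))) (∣m∣n⇒∣m-n p∣rest p∣defect)
    where
    identity : ∀ n a b c →
      n * n ≡ n * (+ 2 * (a + b + c)) + ((a + b + c) * (a + b + c) - + 2 * (a * a + b * b + c * c))
              - ((n + a + b + c) * (n + a + b + c) - + 2 * (n * n + a * a + b * b + c * c))
    identity = solve-∀

indivisible-entry : ∀ q {p} → Descartes q → Unimodular q → Prime p → Σ (Fin 3) λ j → ¬ + p ∣ q (suc j)
indivisible-entry q {p} dq uq prime-p with + p ∣? q 1F | + p ∣? q 2F | + p ∣? q 3F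
... | no p∤a  | _       | _       = 0F , p∤a
... | yes _   | no p∤b  | _       = 1F , p∤b
... | yes _   | yes _   | no p∤c  = 2F , p∤c
... | yes p∣a | yes p∣b | yes p∣c = ⊥-elim (prime∤1 prime-p (uq (+ p) λ
  { 0F → prime∣q₁₂₃⇒prime∣q₀ q dq prime-p p∣a p∣b p∣c ; 1F → p∣a ; 2F → p∣b ; 3F → p∣c }))

-- Circles of nonzero curvature

∣-chain-shift : ∀ q z {d h} → d ∣ h → d ∣ chain q (z + h) → d ∣ chain q z
∣-chain-shift q z {d} {h} d∣h d∣P = ∣m+n∣n⇒∣m (subst (d ∣_) (chain-+ q z h) d∣P) (∣m⇒∣m*n _ d∣h)

2∤∧3∤-chain : ∀ q {z₂ z₃} → ¬ + 2 ∣ chain q z₂ → ¬ + 3 ∣ chain q z₃ →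
              Σ ℤ λ z → (¬ + 2 ∣ chain q z) × (¬ + 3 ∣ chain q z)
2∤∧3∤-chain q {z₂} {z₃} 2∤P₂ 3∤P₃ =
  z₂ + + 2 * (z₂ - z₃) ,
  2∤P₂ ∘ ∣-chain-shift q z₂ (∣m⇒∣m*n (z₂ - z₃) ∣-refl) ,
  3∤P₃ ∘ ∣-chain-shift q z₃ (∣m⇒∣m*n (z₂ - z₃) ∣-refl) ∘ subst (λ z → + 3 ∣ chain q z) (crt z₂ z₃)
  where
  crt : ∀ x y → x + + 2 * (x - y) ≡ y + + 3 * (x - y)
  crt = solve-∀

-- Positions 2 and 3 of relabel π q, where its chain passes at z = 0 and z = -1.
ChainEnd : Permutation′ 4 → Fin 4 → Set
ChainEnd π x = π ⟨$⟩ʳ 2F ≡ x ⊎ π ⟨$⟩ʳ 3F ≡ x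

chain-end : ∀ q π {x} → ChainEnd π x → Σ ℤ λ z → chain (relabel π q) z ≡ q x
chain-end q π (inj₁ refl) = 0ℤ , chain[0] (relabel π q)
chain-end q π (inj₂ refl) = -1ℤ , chain[-1] (relabel π q)

chain-ends-through : ∀ (j k : Fin 3) →
  Σ (Permutation′ 4) λ π → π ⟨$⟩ʳ 0F ≡ 0F × ChainEnd π (suc j) × ChainEnd π (suc k)
chain-ends-through 0F 0F = transpose 1F 2F , refl , inj₁ refl , inj₁ refl
chain-ends-through 0F 1F = transpose 1F 3F , refl , inj₂ refl , inj₁ refl
chain-ends-through 0F 2F = transpose 1F 2F , refl , inj₁ refl , inj₂ refl
chain-ends-through 1F 0F = transpose 1F 3F , refl , inj₁ refl , inj₂ refl
chain-ends-through 1F 1F = id , refl , inj₁ refl , inj₁ refl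
chain-ends-through 1F 2F = id , refl , inj₁ refl , inj₂ refl
chain-ends-through 2F 0F = transpose 1F 2F , refl , inj₂ refl , inj₁ refl
chain-ends-through 2F 1F = id , refl , inj₂ refl , inj₁ refl
chain-ends-through 2F 2F = id , refl , inj₂ refl , inj₂ refl

six-free-chain : ∀ q → Descartes q → Unimodular q →
  Σ Quad λ r → Around 0F q r × Σ ℤ λ z → (¬ + 2 ∣ chain r z) × (¬ + 3 ∣ chain r z)
six-free-chain q dq uq
  with j , 2∤qj ← indivisible-entry q dq uq prime[2]
     | k , 3∤qk ← indivisible-entry q dq uq prime[3]
  with π , π0≡0 , j-end , k-end ← chain-ends-through j k
  with z₂ , P₂≡qj ← chain-end q π j-end
     | z₃ , P₃≡qk ← chain-end q π k-end
  = relabel π q , around-relabel π π0≡0 (λ _ → refl) ,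
    2∤∧3∤-chain (relabel π q) (2∤qj ∘ subst (+ 2 ∣_) P₂≡qj) (3∤qk ∘ subst (+ 3 ∣_) P₃≡qk)

prime-to-6-shift : ∀ q {z₀} → ¬ + 2 ∣ chain q z₀ → ¬ + 3 ∣ chain q z₀ →
                   ∀ t {p} → Prime p → p ℕ.∣ 6 → ¬ + p ∣ chain q (z₀ + + 6 * t)
prime-to-6-shift q {z₀} 2∤P₀ 3∤P₀ t prime-p p∣6 p∣P with prime∣6 prime-p p∣6
... | inj₁ refl = 2∤P₀ (∣-chain-shift q z₀ (∣m⇒∣m*n t (divides (+ 3) refl)) p∣P)
... | inj₂ refl = 3∤P₀ (∣-chain-shift q z₀ (∣m⇒∣m*n t (divides (+ 2) refl)) p∣P)

-- A prime p of q 0 dividing chain q z divides slope q z = slope q z₀ + 12 (q 0 + q 1) t,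
-- so the choice of t (prime to slope q z₀, and divisible by the primes of q 0 that do not
-- divide slope q z₀) forces p ∣ slope q z₀ and then p ∣ 12 (q 0 + q 1), which is excluded.
prime∣q₀⇒∤chain : ∀ q {z₀ t p} → Descartes q → Unimodular q →
  ℕ.Coprime t ∣ slope q z₀ ∣ → (p ℕ.∣ ∣ q 0F ∣ → p ℕ.∣ ∣ slope q z₀ ∣ ⊎ p ℕ.∣ t) →
  Prime p → ¬ p ℕ.∣ 6 → + p ∣ q 0F → ¬ + p ∣ chain q (z₀ + + 6 * + t)
prime∣q₀⇒∤chain q {z₀} {t} {p} dq uq t⊥u split prime-p p∤6 p∣n p∣P = by-factors p∣2A∨p∣6t
  where
  A = q 0F + q 1F
  z = z₀ + + 6 * + t
  p∣slope : + p ∣ slope q z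
  p∣slope = prime∣slope q z dq prime-p p∣n p∣P
  p∣w : + p ∣ slope q z₀ + + 2 * A * (+ 6 * + t)
  p∣w = subst (+ p ∣_) (slope-+ q z₀ (+ 6 * + t)) p∣slope
  p∣u : + p ∣ slope q z₀
  p∣u with split (∣⇒∣ᵤ p∣n)
  ... | inj₁ p∣u = ∣ᵤ⇒∣ p∣u
  ... | inj₂ p∣t = ∣m+n∣n⇒∣m p∣w (∣n⇒∣m*n (+ 2 * A) (∣n⇒∣m*n (+ 6) (∣ᵤ⇒∣ p∣t)))
  p∣2A∨p∣6t : (+ p ∣ + 2 * A) ⊎ (+ p ∣ + 6 * + t)
  p∣2A∨p∣6t = euclidsLemmaℤ (+ 2 * A) (+ 6 * + t) prime-p (∣m+n∣m⇒∣n p∣w p∣u)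
  by-factors : (+ p ∣ + 2 * A) ⊎ (+ p ∣ + 6 * + t) → ⊥
  by-factors (inj₁ p∣2A) with euclidsLemmaℤ (+ 2) A prime-p p∣2A
  ... | inj₁ p∣2 = p∤6 (ℕ.∣-trans (∣⇒∣ᵤ p∣2) (ℕ.divides 3 refl))
  ... | inj₂ p∣A = prime∤1 prime-p (uq (+ p) (∣-entries q z p∣n p∣A p∣slope p∣P))
  by-factors (inj₂ p∣6t) with euclidsLemmaℤ (+ 6) (+ t) prime-p p∣6t
  ... | inj₁ p∣6 = p∤6 (∣⇒∣ᵤ p∣6)
  ... | inj₂ p∣t = ¬prime[1] (subst Prime (t⊥u (∣⇒∣ᵤ p∣t , ∣⇒∣ᵤ p∣u)) prime-p)

coprime-chain-value : ∀ q {z₀} → Descartes q → Unimodular q → q 0F ≢ 0ℤ →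
  ¬ + 2 ∣ chain q z₀ → ¬ + 3 ∣ chain q z₀ → Σ ℤ λ z → Coprime (chain q z) (+ 6 * q 0F)
coprime-chain-value q {z₀} dq uq n≢0 2∤P₀ 3∤P₀
  with t , t⊥u , split ← coprime-part ∣ slope q z₀ ∣ ∣ q 0F ∣ {{≢-nonZero n≢0}}
  = z₀ + + 6 * + t , no-common-prime⇒coprimeℤ excluded
  where
  excluded : ∀ {p} → Prime p → + p ∣ chain q (z₀ + + 6 * + t) → + p ∣ + 6 * q 0F → ⊥
  excluded {p} prime-p p∣P p∣6n =
    [ p∤6 ∘ ∣⇒∣ᵤ , (λ p∣n → prime∣q₀⇒∤chain q dq uq t⊥u (split prime-p) prime-p p∤6 p∣n p∣P) ]′
      (euclidsLemmaℤ (+ 6) (q 0F) prime-p p∣6n)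
    where
    p∤6 : ¬ p ℕ.∣ 6
    p∤6 p∣6 = prime-to-6-shift q 2∤P₀ 3∤P₀ (+ t) prime-p p∣6 p∣P

-- Lines

square-bound : ∀ {a p r} → 4 ℕ.* a ℕ.* p ≡ r ℕ.* r → r ℕ.< 2 ℕ.* a → p ℕ.< a
square-bound {a} {p} {r} 4ap≡r² r<2a =
  ℕ.*-cancelˡ-< (4 ℕ.* a) p a (subst₂ ℕ._<_ (sym 4ap≡r²) (square a) (ℕ.*-mono-< r<2a r<2a))
  where
  square : ∀ a → 2 ℕ.* a ℕ.* (2 ℕ.* a) ≡ 4 ℕ.* a ℕ.* a
  square = ℕ.solve-∀

line-key : ∀ {n a P w} → n ≡ 0ℤ → + 4 * (n + a) * (P + n) ≡ w * w + + 4 * n * n → + 4 * (n + a) * P ≡ w * w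
line-key {a = a} {P} {w} refl 4AP≡w² = trans (identityˡ a P) (trans 4AP≡w² (identityʳ w))
  where
  identityˡ : ∀ a P → + 4 * (0ℤ + a) * P ≡ + 4 * (0ℤ + a) * (P + 0ℤ)
  identityˡ = solve-∀
  identityʳ : ∀ w → w * w + + 4 * 0ℤ * 0ℤ ≡ w * w
  identityʳ = solve-∀

-- For a line, 4 (q 0 + q 1) · chain q z = (slope q z)²; taking z with
-- 0 ≤ slope q z < 2 |q 0 + q 1| makes the chain value smaller than |q 0 + q 1|.
small-chain-value : ∀ q → Descartes q → q 0F ≡ 0ℤ → q 0F + q 1F ≢ 0ℤ →
  Σ ℤ λ z → ∣ chain q z ∣ ℕ.< ∣ q 0F + q 1F ∣ × (chain q z ≡ 0ℤ → chain q (z - 1ℤ) ≡ q 0F + q 1F)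
small-chain-value q dq n≡0 A≢0 = z , |P|<|A| , P≡0⇒
  where
  A = q 0F + q 1F
  B = q 0F + q 1F + q 2F - q 3F
  instance
    2A≢0 : NonZero ∣ + 2 * A ∣
    2A≢0 = ≢-nonZero ([ (λ ()) , A≢0 ]′ ∘ ℤ.i*j≡0⇒i≡0∨j≡0 (+ 2))
  r = B % (+ 2 * A)
  z = - (B / (+ 2 * A))

  slope≡r : slope q z ≡ + r
  slope≡r = trans (cong (λ B → + 2 * A * z + B) (a≡a%n+[a/n]*n B (+ 2 * A)))
                  (identity (+ 2 * A) (B / (+ 2 * A)) (+ r))
    where
    identity : ∀ d Q r → d * - Q + (r + Q * d) ≡ r
    identity = solve-∀

  4AP≡r² : + 4 * A * chain q z ≡ + r * + r
  4AP≡r² = trans (line-key {w = slope q z} n≡0 (key-identity q z dq)) (cong (λ w → w * w) slope≡r)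

  |P|<|A| : ∣ chain q z ∣ ℕ.< ∣ A ∣
  |P|<|A| = square-bound 4|A||P|≡r² (subst (r ℕ.<_) (ℤ.abs-* (+ 2) A) (n%d<d B (+ 2 * A)))
    where
    4|A||P|≡r² : 4 ℕ.* ∣ A ∣ ℕ.* ∣ chain q z ∣ ≡ r ℕ.* r
    4|A||P|≡r² = begin
      4 ℕ.* ∣ A ∣ ℕ.* ∣ chain q z ∣ ≡⟨ cong (ℕ._* ∣ chain q z ∣) (ℤ.abs-* (+ 4) A) ⟨
      ∣ + 4 * A ∣ ℕ.* ∣ chain q z ∣   ≡⟨ ℤ.abs-* (+ 4 * A) (chain q z) ⟨
      ∣ + 4 * A * chain q z ∣          ≡⟨ cong ∣_∣ 4AP≡r² ⟩
      ∣ + r * + r ∣                    ≡⟨ ℤ.abs-* (+ r) (+ r) ⟩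
      r ℕ.* r                          ∎

  P≡0⇒ : chain q z ≡ 0ℤ → chain q (z - 1ℤ) ≡ A
  P≡0⇒ P≡0 = begin
    chain q (z - 1ℤ)                           ≡⟨ chain-+ q z -1ℤ ⟩
    chain q z + -1ℤ * (slope q z + A * -1ℤ)    ≡⟨ cong₂ (λ P w → P + -1ℤ * (w + A * -1ℤ)) P≡0 w≡0 ⟩
    0ℤ + -1ℤ * (0ℤ + A * -1ℤ)                  ≡⟨ identity A ⟩
    A                                          ∎
    where
    r≡0 : + r ≡ 0ℤ
    r≡0 = reduce (ℤ.i*j≡0⇒i≡0∨j≡0 (+ r)
            (trans (sym 4AP≡r²) (trans (cong (λ P → + 4 * A * P) P≡0) (ℤ.*-zeroʳ (+ 4 * A)))))
    w≡0 : slope q z ≡ 0ℤ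
    w≡0 = trans slope≡r r≡0
    identity : ∀ A → 0ℤ + -1ℤ * (0ℤ + A * -1ℤ) ≡ A
    identity = solve-∀

≡0⇒+-identityˡ : ∀ {n} → n ≡ 0ℤ → ∀ x → n + x ≡ x
≡0⇒+-identityˡ refl = ℤ.+-identityˡ

unit⇒coprime : ∀ {x} m → x ∣ 1ℤ → Coprime x m
unit⇒coprime m x∣1 (d∣x , _) = ℕ.∣1⇒≡1 (ℕ.∣-trans d∣x (∣⇒∣ᵤ x∣1))

-- Here q 0 + q 1 divides every curvature of chainQuad q z, so it is ± 1.
unit-neighbour : ∀ m q z → Unimodular q → q 0F ≡ 0ℤ → chain q z ≡ 0ℤ → chain q (z - 1ℤ) ≡ q 0F + q 1F →
                 CoprimeNeighbour m q
unit-neighbour m q z uq n≡0 P≡0 P₋≡A = neighbour (around-chainQuad q z) 2F (unit⇒coprime m P₋∣1)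
  where
  A = q 0F + q 1F
  A∣entries : ∀ k → A ∣ chainQuad q z k
  A∣entries 0F = subst (A ∣_) (sym n≡0) (divides 0ℤ refl)
  A∣entries 1F = subst (A ∣_) (≡0⇒+-identityˡ n≡0 (q 1F)) ∣-refl
  A∣entries 2F = subst (A ∣_) (sym P≡0) (divides 0ℤ refl)
  A∣entries 3F = subst (A ∣_) (sym P₋≡A) ∣-refl
  P₋∣1 : chain q (z - 1ℤ) ∣ 1ℤ
  P₋∣1 = subst (_∣ 1ℤ) (sym P₋≡A) (unimodular-around (around-chainQuad q z) uq A A∣entries)

around-chainQuad-swap₁₂ : ∀ q z → Around 0F q (relabel (transpose 1F 2F) (chainQuad q z))
around-chainQuad-swap₁₂ q z =
  around-trans (around-chainQuad q z) (around-relabel (transpose 1F 2F) refl (λ _ → refl))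

-- Descent on |q 0 + q 1|: the chain circle of smaller curvature becomes the new circle 1,
-- until the chain meets a circle of curvature 0.
line-neighbour : ∀ m q → Descartes q → Unimodular q → q 0F ≡ 0ℤ → q 1F ≢ 0ℤ → CoprimeNeighbour m q
line-neighbour m q dq uq n≡0 a≢0 =
  descend q dq uq n≡0 (a≢0 ∘ trans (sym (≡0⇒+-identityˡ n≡0 (q 1F)))) (<-wellFounded _)
  where
  descend : ∀ q → Descartes q → Unimodular q → q 0F ≡ 0ℤ → q 0F + q 1F ≢ 0ℤ →
            Acc ℕ._<_ ∣ q 0F + q 1F ∣ → CoprimeNeighbour m q
  descend q dq uq n≡0 A≢0 (acc smaller) =
    let z , |P|<|A| , P≡0⇒P₋≡A = small-chain-value q dq n≡0 A≢0
        q⇝s = around-chainQuad-swap₁₂ q z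
    in case chain q z ℤ.≟ 0ℤ of λ where
      (yes P≡0) → unit-neighbour m q z uq n≡0 P≡0 (P≡0⇒P₋≡A P≡0)
      (no P≢0)  → neighbour-around q⇝s
        (descend (relabel (transpose 1F 2F) (chainQuad q z)) (descartes-around q⇝s dq) (unimodular-around q⇝s uq)
                 n≡0 (P≢0 ∘ trans (sym (≡0⇒+-identityˡ n≡0 (chain q z))))
                 (smaller (subst (ℕ._< ∣ q 0F + q 1F ∣) (cong ∣_∣ (sym (≡0⇒+-identityˡ n≡0 (chain q z)))) |P|<|A|)))

nonzero-entry : ∀ q → Descartes q → Unimodular q → Σ (Fin 3) λ j → q (suc j) ≢ 0ℤ
nonzero-entry q dq uq =
  let j , 2∤qj = indivisible-entry q dq uq prime[2]
  in j , λ qj≡0 → 2∤qj (subst (+ 2 ∣_) (sym qj≡0) (divides 0ℤ refl))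

coprime-neighbour : ∀ q → Descartes q → Unimodular q → CoprimeNeighbour (+ 6 * q 0F) q
coprime-neighbour q dq uq with q 0F ℤ.≟ 0ℤ
... | yes n≡0 =
  let j , qj≢0 = nonzero-entry q dq uq
      q⇝r = around-relabel (transpose 1F (suc j)) refl (λ _ → refl)
  in neighbour-around q⇝r (line-neighbour _ _ (descartes-around q⇝r dq) (unimodular-around q⇝r uq) n≡0 qj≢0)
... | no n≢0 =
  let r , q⇝r , z₀ , 2∤P₀ , 3∤P₀ = six-free-chain q dq uq
      z , coprime = coprime-chain-value r (descartes-around q⇝r dq) (unimodular-around q⇝r uq)
                                        (n≢0 ∘ trans (sym (around-0 q⇝r))) 2∤P₀ 3∤P₀
  in neighbour-around q⇝r (chain-neighbour r z (subst (λ n → Coprime (chain r z) (+ 6 * n)) (around-0 q⇝r) coprime))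

neighbour⇒tangent : ∀ {i q q′ m} → Around i q q′ → CoprimeNeighbour m q′ →
  Σ Quad λ s → ReachFix i q s × Σ (Fin 4) λ j → ¬ (j ≡ i) × Coprime (s j) m
neighbour⇒tangent {i} {q} {m = m} q⇝q′ (neighbour q′⇝r j coprime) =
  base q⇝r , reachFix q⇝r , labels q⇝r ⟨$⟩ʳ suc j , j≢i , subst (λ x → Coprime x m) (entries q⇝r (suc j)) coprime
  where
  q⇝r : Around i q _
  q⇝r = around-trans q⇝q′ q′⇝r
  j≢i : labels q⇝r ⟨$⟩ʳ suc j ≢ i
  j≢i e = 0≢1+n (sym (perm-injective (labels q⇝r) (trans e (sym (labels-0 q⇝r)))))

lemma4p9 : (r : Quad) → IntegralDescartesQuad r → Primitive r →
    (q : Quad) → Reach r q → (i : Fin 4) →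
    Σ Quad (λ q′ → ReachFix i q q′ × Σ (Fin 4) (λ j → ¬ (j ≡ i) × Coprime (q′ j) ((+ 6) * q i)))
lemma4p9 r (dr , _) pr q r⇝q i =
  neighbour⇒tangent q⇝q′ (coprime-neighbour q′ (descartes-around q⇝q′ dq) (unimodular-around q⇝q′ uq))
  where
  dq : Descartes q
  dq = reach-preserves Descartes descartes-move r⇝q dr
  uq : Unimodular q
  uq = reach-preserves Unimodular unimodular-move r⇝q (primitive⇒unimodular pr)
  q′ : Quad
  q′ = relabel (transpose 0F i) q
  q⇝q′ : Around i q q′
  q⇝q′ = around-relabel (transpose 0F i) refl (λ _ → refl)
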